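{- Let $T,R$ be rank-1 torsion-free abelian groups with types $t(T)=\tau<\rho=t(R)$, represented by $\tau=(t_p)_{p\in\Pi}$, $\rho=(r_p)_{p\in\Pi}$ with $t_p\leq r_p$ for all primes $p$, and suppose there is an infinite set $P$ of primes such that $t_p=0$ and $0\neq r_p<\infty$ for all $p\in P$. Then there exists a rank-1 torsion-free group $X$ with $\mathrm{Ext}(T,X)=0$ and $\mathrm{Ext}(R,X)\neq0$.
   Context: $\Pi$ is the set of all primes. Types of rank-1 torsion-free groups are represented by characteristics $(t_p)_{p\in\Pi}$, $t_p\in\mathbb{N}\cup\{\infty\}$, modulo changing finitely many finite entries; $\tau<\rho$ means $\tau\leq\rho$ and $\tau\neq\rho$. -}

module Defs where

open import Level using (0ℓ; suc)
open import Data.Nat using (ℕ; zero; _≤_; _^_)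
open import Data.Nat.Primality using (Prime)
open import Data.Unit using (⊤)
open import Data.Empty using (⊥)
open import Data.Product using (Σ; ∃; _×_; _,_)
open import Data.Sum using (_⊎_)
open import Relation.Nullary using (¬_)
open import Relation.Binary.PropositionalEquality using (_≡_; _≢_)
open import Algebra.Bundles using (AbelianGroup)
open import Algebra.Morphism.Structures using (IsGroupHomomorphism)
import Algebra.Definitions.RawMonoid as RM

data ℕ∞ : Set where
  fin : ℕ → ℕ∞
  ∞   : ℕ∞

_≤ᶠ_ : ℕ → ℕ∞ → Set
k ≤ᶠ fin n = k ≤ n
k ≤ᶠ ∞     = ⊤

_≤∞_ : ℕ∞ → ℕ∞ → Set
fin m ≤∞ e = m ≤ᶠ e
∞     ≤∞ fin _ = ⊥
∞     ≤∞ ∞ = ⊤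

-- A characteristic: (t_p) indexed by naturals; only the values at primes matter.
Characteristic : Set
Characteristic = ℕ → ℕ∞

-- Two characteristics represent the same type: they differ at only finitely
-- many primes (all primes ≥ N agree), and only at primes where both are finite.
SameType : Characteristic → Characteristic → Set
SameType χ ψ =
  Σ ℕ (λ N → (∀ p → Prime p → N ≤ p → χ p ≡ ψ p))
  × (∀ p → Prime p → χ p ≡ ∞ → ψ p ≡ ∞)
  × (∀ p → Prime p → ψ p ≡ ∞ → χ p ≡ ∞)

AbGroup : Set₁
AbGroup = AbelianGroup 0ℓ 0ℓ

module _ (A : AbGroup) where
  open AbelianGroup A
  open RM rawMonoid using () renaming (_×_ to _×ℕ_)

  TorsionFree : Set
  TorsionFree = ∀ (n : ℕ) (a : Carrier) → n ≢ 0 → (n ×ℕ a) ≈ ε → a ≈ ε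

  -- rank ≤ 1 and nonzero: any two elements are ℤ-linearly dependent
  RankOne : Set
  RankOne =
    (Σ Carrier (λ a → ¬ (a ≈ ε)))
    × (∀ (a b : Carrier) → Σ ℕ (λ m → Σ ℕ (λ n →
         ¬ (m ≡ 0 × n ≡ 0) × ((m ×ℕ a ≈ n ×ℕ b) ⊎ ((m ×ℕ a) ∙ (n ×ℕ b) ≈ ε)))))

  RankOneTorsionFree : Set
  RankOneTorsionFree = TorsionFree × RankOne

  DivIn : ℕ → Carrier → Set
  DivIn d a = Σ Carrier (λ y → d ×ℕ y ≈ a)

  IsCharOf : Carrier → Characteristic → Set
  IsCharOf a χ = ∀ p → Prime p → ∀ (k : ℕ) →
    (DivIn (p ^ k) a → k ≤ᶠ χ p) × (k ≤ᶠ χ p → DivIn (p ^ k) a)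

  HasType : Characteristic → Set
  HasType τ = Σ Carrier (λ a → ¬ (a ≈ ε) × Σ Characteristic (λ χ → IsCharOf a χ × SameType χ τ))

IsHom : (A B : AbGroup) → (AbelianGroup.Carrier A → AbelianGroup.Carrier B) → Set
IsHom A B f = IsGroupHomomorphism (AbelianGroup.rawGroup A) (AbelianGroup.rawGroup B) f

record ShortExact (X E T : AbGroup) : Set where
  module X = AbelianGroup X
  module E = AbelianGroup E
  module T = AbelianGroup T
  field
    ι : X.Carrier → E.Carrier
    π : E.Carrier → T.Carrier
    ι-hom : IsHom X E ι
    π-hom : IsHom E T π
    ι-inj : ∀ x y → ι x E.≈ ι y → x X.≈ y
    π-surj : ∀ t → Σ E.Carrier (λ e → π e T.≈ t)
    πι≈0 : ∀ x → π (ι x) T.≈ T.ε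
    ker⊆im : ∀ e → π e T.≈ T.ε → Σ X.Carrier (λ x → ι x E.≈ e)

Splits : {X E T : AbGroup} → ShortExact X E T → Set
Splits {X} {E} {T} s =
  Σ (AbelianGroup.Carrier T → AbelianGroup.Carrier E)
    (λ σ → IsHom T E σ × (∀ t → AbelianGroup._≈_ T (ShortExact.π s (σ t)) t))

ExtZero : AbGroup → AbGroup → Set₁
ExtZero T X = ∀ (E : AbGroup) (s : ShortExact X E T) → Splits s

-- Pick primes s₀ < s₁ < … in P beyond the finitely many places where the characteristics of
-- chosen elements a ∈ T and b ∈ R differ from τ and ρ, so that no sᵢ divides a while every sᵢ
-- divides b, and let X ⊆ ℚ consist of the rationals with no sᵢ in the denominator.
--
-- Ext(T, X) = 0: writing t ∈ T as (u / v) · a in lowest terms, no sᵢ divides v, for otherwise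
-- a would be sᵢ-divisible. In an extension E, lift a to e₀ and t to e; then v e − u e₀ comes
-- from X, which is divisible by v, and correcting e by the quotient gives a lift of t with
-- coordinate u / v relative to e₀. Elements of the torsion-free group E are determined by their
-- coordinates, so these lifts form a splitting.
--
-- Ext(R, X) ≠ 0: let E ⊆ R × ℚ consist of the pairs (r, y) such that, for r = q · b, y − q is
-- sᵢ-integral for odd i and y is sᵢ-integral for even i. The Chinese remainder theorem makes
-- E → R onto, with kernel X. A splitting with σ(b) = (b, l) sends b / sᵢ to (b / sᵢ, l / sᵢ),
-- so l / sᵢ − 1 / sᵢ would be sᵢ-integral for odd i and l / sᵢ for even i, impossible for large i.

module Submission where

open import Defs
open import Data.Nat using (ℕ; _≤_; suc)
open import Data.Nat.Primality using (Prime)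
open import Data.Product using (Σ; _×_)
open import Relation.Nullary using (¬_)
open import Relation.Binary.PropositionalEquality using (_≡_)

open import Data.Nat as ℕ using (zero; _<_; s≤s; z≤n; _^_; parity)
open import Data.Parity using (Parity; 0ℙ; 1ℙ)
import Data.Parity.Base as ℙ
import Data.Parity.Properties as ParityP
import Data.Nat.Properties as ℕP
open import Data.Nat.Divisibility using (_∣_; divides; _∣?_; ∣⇒≤; ∣-trans; ∣-refl; n∣m*n)
open import Data.Nat.Primality using (euclidsLemma; prime⇒nonZero; prime⇒nonTrivial; prime⇒irreducible)
open import Data.Nat.Coprimality using (Coprime; coprime-Bézout)
import Data.Nat.Coprimality as Coprimality
open import Data.Nat.GCD using (module Bézout)
open import Data.Integer as ℤ using (ℤ; +_; -[1+_]; ∣_∣; _⊖_)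
import Data.Integer.Properties as ℤP
open import Data.Integer.Tactic.RingSolver using (solve-∀)
open import Data.Rational.Unnormalised as Q using (ℚᵘ; mkℚᵘ; _≃_; *≡*; ↥_; ↧ₙ_; 0ℚᵘ; 1ℚᵘ)
import Data.Rational.Unnormalised.Properties as QP
import Data.Rational as ℚ
import Data.Rational.Properties as ℚP
open import Data.Product using (_,_; proj₁; proj₂)
open import Data.Sum using (_⊎_; inj₁; inj₂)
import Data.Sum as Sum
open import Data.Empty using (⊥-elim)
open import Relation.Nullary using (yes; no)
open import Relation.Binary.PropositionalEquality using (_≢_)
import Relation.Binary.PropositionalEquality as P
open import Algebra.Bundles using (AbelianGroup)
open import Algebra.Morphism.Structures using (module IsGroupHomomorphism)
import Algebra.Definitions.RawMonoid as RawMonoid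
import Algebra.Construct.DirectProduct as DirectProduct
import Algebra.Properties.Monoid.Mult as MonoidMult
import Algebra.Properties.CommutativeMonoid.Mult as CommutativeMonoidMult
import Algebra.Properties.CommutativeSemigroup as CommutativeSemigroupProperties
import Algebra.Properties.AbelianGroup as AbelianGroupProperties
import Relation.Binary.Reasoning.Setoid as SetoidReasoning

-- Arithmetic of ℤ and of p-integral rationals

factor-out : ∀ s → 1 < s → ∀ d → Σ ℕ λ k → Σ ℕ λ w → suc d ≡ s ^ k ℕ.* suc w × ¬ s ∣ suc w
factor-out s 1<s d = go (suc d) d ℕP.≤-refl
  where
  go : ∀ fuel d → suc d ≤ fuel → Σ ℕ λ k → Σ ℕ λ w → suc d ≡ s ^ k ℕ.* suc w × ¬ s ∣ suc w
  go (suc fuel) d (s≤s d<fuel) with s ∣? suc d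
  ... | no  s∤d = 0 , d , P.sym (ℕP.+-identityʳ (suc d)) , s∤d
  ... | yes (divides (suc q) d≡qs) with go fuel q (ℕP.≤-trans q<d d<fuel)
    where
    q<d : suc q ≤ d
    q<d = ℕP.≤-pred (P.subst (suc (suc q) ≤_) (P.sym d≡qs) (ℕP.m<m*n (suc q) s 1<s))
  ... | k , w , q≡skw , s∤w = suc k , w , (begin
      suc d                   ≡⟨ d≡qs ⟩
      suc q ℕ.* s             ≡⟨ P.cong (ℕ._* s) q≡skw ⟩
      s ^ k ℕ.* suc w ℕ.* s   ≡⟨ ℕP.*-comm (s ^ k ℕ.* suc w) s ⟩
      s ℕ.* (s ^ k ℕ.* suc w) ≡⟨ P.sym (ℕP.*-assoc s (s ^ k) (suc w)) ⟩
      s ^ suc k ℕ.* suc w     ∎) , s∤w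
    where open P.≡-Reasoning

prime⇒1< : ∀ {p} → Prime p → 1 < p
prime⇒1< {p} p-prime = ℕ.nonTrivial⇒n>1 p {{prime⇒nonTrivial p-prime}}

prime∤1 : ∀ {p} → Prime p → ¬ p ∣ 1
prime∤1 p-prime p∣1 = ℕP.<⇒≱ (prime⇒1< p-prime) (∣⇒≤ p∣1)

∣∧<⇒≡0 : ∀ {s m} → s ∣ m → m < s → m ≡ 0
∣∧<⇒≡0 {m = zero}  _   _   = P.refl
∣∧<⇒≡0 {m = suc m} s∣m m<s = ⊥-elim (ℕP.<⇒≱ m<s (∣⇒≤ s∣m))

InvertibleModulo : ℕ → ℤ → Set
InvertibleModulo a w = Σ ℤ λ β → Σ ℤ λ γ → β ℤ.* w ℤ.+ γ ℤ.* + a ≡ + 1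

invertibleModulo-1 : ∀ w → InvertibleModulo 1 w
invertibleModulo-1 w = + 0 , + 1 , P.refl

invertibleModulo-* : ∀ {a b w} → InvertibleModulo a w → InvertibleModulo b w → InvertibleModulo (a ℕ.* b) w
invertibleModulo-* {a} {b} {w} (β₁ , γ₁ , β₁w+γ₁a≡1) (β₂ , γ₂ , β₂w+γ₂b≡1) = β , γ₁ ℤ.* γ₂ , (begin
  β ℤ.* w ℤ.+ (γ₁ ℤ.* γ₂) ℤ.* + (a ℕ.* b)
    ≡⟨ P.cong (λ t → β ℤ.* w ℤ.+ (γ₁ ℤ.* γ₂) ℤ.* t) (ℤP.pos-* a b) ⟩
  β ℤ.* w ℤ.+ (γ₁ ℤ.* γ₂) ℤ.* (+ a ℤ.* + b)
    ≡⟨ regroup β w γ₁ γ₂ (+ a) (+ b) ⟩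
  β ℤ.* w ℤ.+ (γ₁ ℤ.* + a) ℤ.* (γ₂ ℤ.* + b)
    ≡⟨ P.cong₂ (λ x y → β ℤ.* w ℤ.+ x ℤ.* y)
               (complement (β₁ ℤ.* w) _ β₁w+γ₁a≡1) (complement (β₂ ℤ.* w) _ β₂w+γ₂b≡1) ⟩
  β ℤ.* w ℤ.+ (+ 1 ℤ.- β₁ ℤ.* w) ℤ.* (+ 1 ℤ.- β₂ ℤ.* w)
    ≡⟨ expand β₁ β₂ w ⟩
  + 1 ∎)
  where
  open P.≡-Reasoning
  β : ℤ
  β = β₁ ℤ.+ β₂ ℤ.- β₁ ℤ.* β₂ ℤ.* w
  complement : ∀ x y → x ℤ.+ y ≡ + 1 → y ≡ + 1 ℤ.- x
  complement x y x+y≡1 = P.trans (cancelˡ x y) (P.cong (ℤ._- x) x+y≡1)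
    where
    cancelˡ : ∀ x y → y ≡ x ℤ.+ y ℤ.- x
    cancelˡ = solve-∀
  regroup : ∀ β w γ₁ γ₂ a b → β ℤ.* w ℤ.+ (γ₁ ℤ.* γ₂) ℤ.* (a ℤ.* b) ≡ β ℤ.* w ℤ.+ (γ₁ ℤ.* a) ℤ.* (γ₂ ℤ.* b)
  regroup = solve-∀
  expand : ∀ β₁ β₂ w →
    (β₁ ℤ.+ β₂ ℤ.- β₁ ℤ.* β₂ ℤ.* w) ℤ.* w ℤ.+ (+ 1 ℤ.- β₁ ℤ.* w) ℤ.* (+ 1 ℤ.- β₂ ℤ.* w) ≡ + 1
  expand = solve-∀

invertibleModulo-neg : ∀ {a w} → InvertibleModulo a w → InvertibleModulo a (ℤ.- w)
invertibleModulo-neg {w = w} (β , γ , e) =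
  ℤ.- β , γ , P.trans (P.cong (ℤ._+ _) (neg*neg β w)) e
  where
  neg*neg : ∀ β w → (ℤ.- β) ℤ.* (ℤ.- w) ≡ β ℤ.* w
  neg*neg = solve-∀

invertibleModulo-∣∣ : ∀ {a} w → InvertibleModulo a (+ ∣ w ∣) → InvertibleModulo a w
invertibleModulo-∣∣ (+ n)    inv = inv
invertibleModulo-∣∣ -[1+ n ] inv = invertibleModulo-neg inv

bézout⇒inverse : ∀ x y n m → 1 ℕ.+ y ℕ.* n ≡ x ℕ.* m → (ℤ.- + y) ℤ.* + n ℤ.+ + x ℤ.* + m ≡ + 1
bézout⇒inverse x y n m e = P.trans (P.cong (ℤ._+_ ((ℤ.- + y) ℤ.* + n)) (P.sym e′)) (cancel (+ y) (+ n))
  where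
  e′ : + 1 ℤ.+ + y ℤ.* + n ≡ + x ℤ.* + m
  e′ = P.trans (P.cong (ℤ._+_ (+ 1)) (P.sym (ℤP.pos-* y n)))
         (P.trans (P.sym (ℤP.pos-+ 1 (y ℕ.* n))) (P.trans (P.cong +_ e) (ℤP.pos-* x m)))
  cancel : ∀ y n → (ℤ.- y) ℤ.* n ℤ.+ (+ 1 ℤ.+ y ℤ.* n) ≡ + 1
  cancel = solve-∀

module _ {p : ℕ} (p-prime : Prime p) where

  p∤* : ∀ {m n} → ¬ p ∣ m → ¬ p ∣ n → ¬ p ∣ m ℕ.* n
  p∤* p∤m p∤n p∣mn with euclidsLemma _ _ p-prime p∣mn
  ... | inj₁ p∣m = p∤m p∣m
  ... | inj₂ p∣n = p∤n p∣n

  p∤⇒coprime : ∀ {n} → ¬ p ∣ n → Coprime p n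
  p∤⇒coprime p∤n (d∣p , d∣n) with prime⇒irreducible p-prime d∣p
  ... | inj₁ d≡1 = d≡1
  ... | inj₂ P.refl = ⊥-elim (p∤n d∣n)

  invertibleModulo-prime : ∀ {w} → ¬ p ∣ ∣ w ∣ → InvertibleModulo p w
  invertibleModulo-prime {w} p∤w = invertibleModulo-∣∣ w (from-Bézout (coprime-Bézout (p∤⇒coprime p∤w)))
    where
    from-Bézout : Bézout.Identity 1 p ∣ w ∣ → InvertibleModulo p (+ ∣ w ∣)
    from-Bézout (Bézout.+- x y e) = ℤ.- + y , + x , bézout⇒inverse x y ∣ w ∣ p e
    from-Bézout (Bézout.-+ x y e) =
      + y , ℤ.- + x , P.trans (ℤP.+-comm (+ y ℤ.* + ∣ w ∣) _) (bézout⇒inverse y x p ∣ w ∣ e)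

  invertibleModulo-^ : ∀ {w} → ¬ p ∣ ∣ w ∣ → ∀ k → InvertibleModulo (p ^ k) w
  invertibleModulo-^ p∤w zero    = invertibleModulo-1 _
  invertibleModulo-^ p∤w (suc k) = invertibleModulo-* (invertibleModulo-prime p∤w) (invertibleModulo-^ p∤w k)

  prime∣p^k⇒≡p : ∀ {q} → Prime q → ∀ k → q ∣ p ^ k → q ≡ p
  prime∣p^k⇒≡p {q} q-prime zero    q∣1 = ⊥-elim (prime∤1 q-prime q∣1)
  prime∣p^k⇒≡p {q} q-prime (suc k) q∣p^sk with euclidsLemma p (p ^ k) q-prime q∣p^sk
  ... | inj₂ q∣p^k = prime∣p^k⇒≡p q-prime k q∣p^k
  ... | inj₁ q∣p with prime⇒irreducible p-prime q∣p
  ...   | inj₁ q≡1 = ⊥-elim (prime∤1 q-prime (P.subst (_∣ 1) (P.sym q≡1) ∣-refl))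
  ...   | inj₂ q≡p = q≡p

+-same-denominator : ∀ a b d → mkℚᵘ a d Q.+ mkℚᵘ b d ≃ mkℚᵘ (a ℤ.+ b) d
+-same-denominator a b d = *≡* (P.trans (factor a b (+ suc d))
  (P.cong ((a ℤ.+ b) ℤ.*_) (P.sym (ℤP.pos-* (suc d) (suc d)))))
  where
  factor : ∀ a b D → (a ℤ.* D ℤ.+ b ℤ.* D) ℤ.* D ≡ (a ℤ.+ b) ℤ.* (D ℤ.* D)
  factor = solve-∀

*-cancel-denominator : ∀ x m d w → suc d ≡ m ℕ.* suc w → mkℚᵘ (x ℤ.* + m) d ≃ mkℚᵘ x w
*-cancel-denominator x m d w d≡mw = *≡* (P.trans (ℤP.*-assoc x (+ m) (+ suc w))
  (P.cong (x ℤ.*_) (P.trans (P.sym (ℤP.pos-* m (suc w))) (P.cong +_ (P.sym d≡mw)))))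

*-clear-denominator : ∀ k x d → mkℚᵘ x d Q.* mkℚᵘ (+ (k ℕ.* suc d)) 0 ≃ mkℚᵘ (+ k ℤ.* x) 0
*-clear-denominator k x d = *≡* (P.trans (P.cong (λ t → (x ℤ.* t) ℤ.* + 1) (ℤP.pos-* k (suc d)))
  (P.trans (rearrange x (+ k) (+ suc d)) (P.cong ((+ k ℤ.* x) ℤ.*_) (P.sym (ℤP.pos-* (suc d) 1)))))
  where
  rearrange : ∀ x k d → (x ℤ.* (k ℤ.* d)) ℤ.* + 1 ≡ (k ℤ.* x) ℤ.* (d ℤ.* + 1)
  rearrange = solve-∀

suc≡*⇒nonzero : ∀ m n d → suc d ≡ m ℕ.* n → Σ ℕ λ m-1 → m ≡ suc m-1
suc≡*⇒nonzero zero    n d ()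
suc≡*⇒nonzero (suc m) n d _ = m , P.refl

Integral : ℕ → ℚᵘ → Set
Integral p q = Σ ℤ λ z → Σ ℕ λ w → ¬ p ∣ suc w × q ≃ mkℚᵘ z w

integral-resp-≃ : ∀ {p q q′} → q ≃ q′ → Integral p q → Integral p q′
integral-resp-≃ q≃q′ (z , w , p∤w , q≃z/w) = z , w , p∤w , QP.≃-trans (QP.≃-sym q≃q′) q≃z/w

integral-neg : ∀ {p q} → Integral p q → Integral p (Q.- q)
integral-neg (z , w , p∤w , q≃z/w) = ℤ.- z , w , p∤w , QP.-‿cong q≃z/w

module _ {p : ℕ} (p-prime : Prime p) where

  integral-mkℚᵘ : ∀ z w → ¬ p ∣ suc w → Integral p (mkℚᵘ z w)
  integral-mkℚᵘ z w p∤w = z , w , p∤w , QP.≃-refl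

  integral-ℤ : ∀ z → Integral p (mkℚᵘ z 0)
  integral-ℤ z = integral-mkℚᵘ z 0 (prime∤1 p-prime)

  integral-0 : Integral p 0ℚᵘ
  integral-0 = integral-ℤ (+ 0)

  integral-+ : ∀ {q q′} → Integral p q → Integral p q′ → Integral p (q Q.+ q′)
  integral-+ (_ , _ , p∤w , e) (_ , _ , p∤w′ , e′) = _ , _ , p∤* p-prime p∤w p∤w′ , QP.+-cong e e′

  integral-* : ∀ {q q′} → Integral p q → Integral p q′ → Integral p (q Q.* q′)
  integral-* (_ , _ , p∤w , e) (_ , _ , p∤w′ , e′) = _ , _ , p∤* p-prime p∤w p∤w′ , QP.*-cong e e′

  integral∧p∣denominator⇒p∣numerator : ∀ {n d} → Integral p (mkℚᵘ n d) → p ∣ suc d → p ∣ ∣ n ∣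
  integral∧p∣denominator⇒p∣numerator {n} {d} (z , w , p∤w , *≡* nw≡zd) p∣d
    with euclidsLemma ∣ n ∣ (suc w) p-prime (P.subst (p ∣_) ∣zd∣≡∣nw∣ (∣-trans p∣d (n∣m*n ∣ z ∣)))
    where
    ∣zd∣≡∣nw∣ : ∣ z ∣ ℕ.* suc d ≡ ∣ n ∣ ℕ.* suc w
    ∣zd∣≡∣nw∣ = P.trans (P.sym (ℤP.abs-* z (+ suc d)))
                  (P.trans (P.cong ∣_∣ (P.sym nw≡zd)) (ℤP.abs-* n (+ suc w)))
  ... | inj₁ p∣n = p∣n
  ... | inj₂ p∣w = ⊥-elim (p∤w p∣w)

integral-l/p-e/p⇒p∣ : ∀ {p k} → Prime p → p ≡ suc k → ∀ L dl e →
  Integral p (mkℚᵘ L dl Q.* mkℚᵘ (+ 1) k Q.- mkℚᵘ e k) → p ∣ ∣ L ℤ.- e ℤ.* + suc dl ∣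
integral-l/p-e/p⇒p∣ {k = k} p-prime P.refl L dl e integral =
  integral∧p∣denominator⇒p∣numerator p-prime (integral-resp-≃ common-denominator integral) (n∣m*n (suc dl))
  where
  rearrange : ∀ L e D K → ((L ℤ.* + 1) ℤ.* K ℤ.+ (ℤ.- e) ℤ.* (D ℤ.* K)) ℤ.* (D ℤ.* K)
                        ≡ (L ℤ.- e ℤ.* D) ℤ.* ((D ℤ.* K) ℤ.* K)
  rearrange = solve-∀
  common-denominator : mkℚᵘ L dl Q.* mkℚᵘ (+ 1) k Q.- mkℚᵘ e k
                     ≃ mkℚᵘ (L ℤ.- e ℤ.* + suc dl) (k ℕ.+ dl ℕ.* suc k)
  common-denominator = *≡* (P.trans
    (P.cong₂ (λ x y → ((L ℤ.* + 1) ℤ.* + suc k ℤ.+ (ℤ.- e) ℤ.* x) ℤ.* y)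
      (ℤP.pos-* (suc dl) (suc k)) (ℤP.pos-* (suc dl) (suc k)))
    (P.trans (rearrange L e (+ suc dl) (+ suc k)) (P.cong ((L ℤ.- e ℤ.* + suc dl) ℤ.*_)
      (P.trans (P.cong (ℤ._* + suc k) (P.sym (ℤP.pos-* (suc dl) (suc k))))
               (P.sym (ℤP.pos-* (suc dl ℕ.* suc k) (suc k)))))))

-- Abelian groups: integer multiples and coordinates

module IntegerMultiples (G : AbGroup) where
  open AbelianGroup G public
  open RawMonoid rawMonoid public using () renaming (_×_ to _×ℕ_)
  open MonoidMult monoid public
  open CommutativeMonoidMult commutativeMonoid public using (×-distrib-+)
  open CommutativeSemigroupProperties commutativeSemigroup public using (interchange)
  open AbelianGroupProperties G public
  open SetoidReasoning setoid public

  ×-swap : ∀ m n g → m ×ℕ (n ×ℕ g) ≈ n ×ℕ (m ×ℕ g)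
  ×-swap m n g = begin
    m ×ℕ (n ×ℕ g)   ≈⟨ ×-assocˡ g m n ⟩
    (m ℕ.* n) ×ℕ g  ≡⟨ P.cong (_×ℕ g) (ℕP.*-comm m n) ⟩
    (n ℕ.* m) ×ℕ g  ≈⟨ sym (×-assocˡ g n m) ⟩
    n ×ℕ (m ×ℕ g)   ∎

  infixr 8 _·_
  _·_ : ℤ → Carrier → Carrier
  (+ n)    · g = n ×ℕ g
  -[1+ n ] · g = (suc n ×ℕ g) ⁻¹

  ·-cong : ∀ z {g h} → g ≈ h → z · g ≈ z · h
  ·-cong (+ n)    e = ×-congʳ n e
  ·-cong -[1+ n ] e = ⁻¹-cong (×-congʳ (suc n) e)

  ×-ε : ∀ n → n ×ℕ ε ≈ ε
  ×-ε zero    = refl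
  ×-ε (suc n) = trans (identityˡ _) (×-ε n)

  ·-ε : ∀ z → z · ε ≈ ε
  ·-ε (+ n)    = ×-ε n
  ·-ε -[1+ n ] = trans (⁻¹-cong (×-ε (suc n))) ε⁻¹≈ε

  ·-distrib-∙ : ∀ z g h → z · (g ∙ h) ≈ z · g ∙ z · h
  ·-distrib-∙ (+ n)    g h = ×-distrib-+ g h n
  ·-distrib-∙ -[1+ n ] g h = trans (⁻¹-cong (×-distrib-+ g h (suc n))) (sym (⁻¹-∙-comm _ _))

  ·-⁻¹ : ∀ z g → z · (g ⁻¹) ≈ (z · g) ⁻¹
  ·-⁻¹ z g = inverseʳ-unique (z · g) (z · (g ⁻¹))
    (trans (sym (·-distrib-∙ z g (g ⁻¹))) (trans (·-cong z (inverseʳ g)) (·-ε z)))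

  ⊖-· : ∀ m n g → (m ⊖ n) · g ≈ m ×ℕ g ∙ (n ×ℕ g) ⁻¹
  ⊖-· m       zero    g = sym (trans (∙-congˡ ε⁻¹≈ε) (identityʳ _))
  ⊖-· zero    (suc n) g = sym (identityˡ _)
  ⊖-· (suc m) (suc n) g = begin
    (suc m ⊖ suc n) · g                   ≡⟨ P.cong (_· g) (ℤP.[1+m]⊖[1+n]≡m⊖n m n) ⟩
    (m ⊖ n) · g                           ≈⟨ ⊖-· m n g ⟩
    m ×ℕ g ∙ (n ×ℕ g) ⁻¹                  ≈⟨ sym (identityˡ _) ⟩
    ε ∙ (m ×ℕ g ∙ (n ×ℕ g) ⁻¹)            ≈⟨ ∙-congʳ (sym (inverseʳ g)) ⟩
    (g ∙ g ⁻¹) ∙ (m ×ℕ g ∙ (n ×ℕ g) ⁻¹)   ≈⟨ interchange _ _ _ _ ⟩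
    (g ∙ m ×ℕ g) ∙ (g ⁻¹ ∙ (n ×ℕ g) ⁻¹)   ≈⟨ ∙-congˡ (⁻¹-∙-comm _ _) ⟩
    (g ∙ m ×ℕ g) ∙ (g ∙ n ×ℕ g) ⁻¹        ∎

  ·-homo-+ : ∀ z w g → (z ℤ.+ w) · g ≈ z · g ∙ w · g
  ·-homo-+ (+ m)    (+ n)    g = ×-homo-+ g m n
  ·-homo-+ (+ m)    -[1+ n ] g = ⊖-· m (suc n) g
  ·-homo-+ -[1+ m ] (+ n)    g = trans (⊖-· n (suc m) g) (comm _ _)
  ·-homo-+ -[1+ m ] -[1+ n ] g = begin
    (suc (suc (m ℕ.+ n)) ×ℕ g) ⁻¹      ≡⟨ P.cong (λ k → (suc k ×ℕ g) ⁻¹) (P.sym (ℕP.+-suc m n)) ⟩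
    ((suc m ℕ.+ suc n) ×ℕ g) ⁻¹        ≈⟨ ⁻¹-cong (×-homo-+ g (suc m) (suc n)) ⟩
    (suc m ×ℕ g ∙ suc n ×ℕ g) ⁻¹       ≈⟨ sym (⁻¹-∙-comm _ _) ⟩
    (suc m ×ℕ g) ⁻¹ ∙ (suc n ×ℕ g) ⁻¹  ∎

  ·-homo-neg : ∀ z g → (ℤ.- z) · g ≈ (z · g) ⁻¹
  ·-homo-neg z g = inverseʳ-unique (z · g) ((ℤ.- z) · g)
    (trans (sym (·-homo-+ z (ℤ.- z) g)) (P.subst (λ k → k · g ≈ ε) (P.sym (ℤP.+-inverseʳ z)) refl))

  ·-identityˡ : ∀ g → (+ 1) · g ≈ g
  ·-identityˡ = identityʳ

  ·-*ℕ : ∀ n z g → (+ n ℤ.* z) · g ≈ n ×ℕ (z · g)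
  ·-*ℕ zero    z g = P.subst (λ k → k · g ≈ ε) (P.sym (ℤP.*-zeroˡ z)) refl
  ·-*ℕ (suc n) z g = begin
    (+ suc n ℤ.* z) · g                ≡⟨ P.cong (_· g) (ℤP.suc-* (+ n) z) ⟩
    (z ℤ.+ + n ℤ.* z) · g              ≈⟨ ·-homo-+ z (+ n ℤ.* z) g ⟩
    z · g ∙ (+ n ℤ.* z) · g            ≈⟨ ∙-congˡ (·-*ℕ n z g) ⟩
    z · g ∙ n ×ℕ (z · g)               ∎

  ·-assoc : ∀ z w g → (z ℤ.* w) · g ≈ z · (w · g)
  ·-assoc (+ n)    w g = ·-*ℕ n w g
  ·-assoc -[1+ n ] w g = begin
    (-[1+ n ] ℤ.* w) · g               ≡⟨ P.cong (_· g) (P.sym (ℤP.neg-distribˡ-* (+ suc n) w)) ⟩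
    (ℤ.- (+ suc n ℤ.* w)) · g          ≈⟨ ·-homo-neg (+ suc n ℤ.* w) g ⟩
    ((+ suc n ℤ.* w) · g) ⁻¹           ≈⟨ ⁻¹-cong (·-*ℕ (suc n) w g) ⟩
    (suc n ×ℕ (w · g)) ⁻¹              ∎

  ·-·-comm : ∀ z w g → z · (w · g) ≈ w · (z · g)
  ·-·-comm z w g = begin
    z · (w · g)      ≈⟨ sym (·-assoc z w g) ⟩
    (z ℤ.* w) · g    ≡⟨ P.cong (_· g) (ℤP.*-comm z w) ⟩
    (w ℤ.* z) · g    ≈⟨ ·-assoc w z g ⟩
    w · (z · g)      ∎

module Subgroup (A : AbGroup) (P : AbelianGroup.Carrier A → Set)
  (P-∙ : ∀ {x y} → P x → P y → P (AbelianGroup._∙_ A x y))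
  (P-ε : P (AbelianGroup.ε A))
  (P-⁻¹ : ∀ {x} → P x → P (AbelianGroup._⁻¹ A x)) where
  private module A = AbelianGroup A

  subgroup : AbGroup
  subgroup = record
    { Carrier = Σ A.Carrier P
    ; _≈_ = λ x y → proj₁ x A.≈ proj₁ y
    ; _∙_ = λ { (x , p) (y , q) → x A.∙ y , P-∙ p q }
    ; ε = A.ε , P-ε
    ; _⁻¹ = λ { (x , p) → x A.⁻¹ , P-⁻¹ p }
    ; isAbelianGroup = record
      { isGroup = record
        { isMonoid = record
          { isSemigroup = record
            { isMagma = record
              { isEquivalence = record { refl = A.refl ; sym = A.sym ; trans = A.trans }
              ; ∙-cong = A.∙-cong }
            ; assoc = λ x y z → A.assoc (proj₁ x) (proj₁ y) (proj₁ z) }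
          ; identity = (λ x → A.identityˡ (proj₁ x)) , (λ x → A.identityʳ (proj₁ x)) }
        ; inverse = (λ x → A.inverseˡ (proj₁ x)) , (λ x → A.inverseʳ (proj₁ x))
        ; ⁻¹-cong = A.⁻¹-cong }
      ; comm = λ x y → A.comm (proj₁ x) (proj₁ y) } }

  open RawMonoid (AbelianGroup.rawMonoid subgroup) using () renaming (_×_ to _×S_)
  open RawMonoid A.rawMonoid using () renaming (_×_ to _×A_)

  ×-proj₁ : ∀ n x → proj₁ (n ×S x) A.≈ n ×A proj₁ x
  ×-proj₁ zero    x = A.refl
  ×-proj₁ (suc n) x = A.∙-congˡ (×-proj₁ n x)

  subgroup-torsionFree : TorsionFree A → TorsionFree subgroup
  subgroup-torsionFree torsionFree n x n≢0 nx≈ε =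
    torsionFree n (proj₁ x) n≢0 (A.trans (A.sym (×-proj₁ n x)) nx≈ε)

  subgroup-rankOne : RankOne A → Σ (Σ A.Carrier P) (λ x → ¬ proj₁ x A.≈ A.ε) → RankOne subgroup
  subgroup-rankOne (_ , dependent) nonzero = nonzero , λ x y →
    let m , n , nontrivial , relation = dependent (proj₁ x) (proj₁ y) in
    m , n , nontrivial , Sum.map
      (λ mx≈ny → A.trans (×-proj₁ m x) (A.trans mx≈ny (A.sym (×-proj₁ n y))))
      (A.trans (A.∙-cong (×-proj₁ m x) (×-proj₁ n y)))
      relation

module _ (A : AbGroup) where
  open AbelianGroup A
  open RawMonoid rawMonoid using () renaming (_×_ to _×ℕ_)

  Dependent : Carrier → Carrier → Set
  Dependent x y = Σ ℕ λ m → Σ ℕ λ n → ¬ (m ≡ 0 × n ≡ 0) × ((m ×ℕ x ≈ n ×ℕ y) ⊎ (m ×ℕ x ∙ n ×ℕ y ≈ ε))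

isHom : (A B : AbGroup) (f : AbelianGroup.Carrier A → AbelianGroup.Carrier B) →
  (∀ {x y} → AbelianGroup._≈_ A x y → AbelianGroup._≈_ B (f x) (f y)) →
  (∀ x y → AbelianGroup._≈_ B (f (AbelianGroup._∙_ A x y)) (AbelianGroup._∙_ B (f x) (f y))) →
  AbelianGroup._≈_ B (f (AbelianGroup.ε A)) (AbelianGroup.ε B) →
  (∀ x → AbelianGroup._≈_ B (f (AbelianGroup._⁻¹ A x)) (AbelianGroup._⁻¹ B (f x))) →
  IsHom A B f
isHom A B f cong homo ε-homo ⁻¹-homo = record
  { isMonoidHomomorphism = record
    { isMagmaHomomorphism = record { isRelHomomorphism = record { cong = cong } ; homo = homo }
    ; ε-homo = ε-homo }
  ; ⁻¹-homo = ⁻¹-homo }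

module HomomorphismProperties {A B : AbGroup} {f : AbelianGroup.Carrier A → AbelianGroup.Carrier B}
  (f-hom : IsHom A B f) where
  private
    module A = IntegerMultiples A
    module B = IntegerMultiples B
  open IsGroupHomomorphism f-hom public

  homo-× : ∀ n g → f (n A.×ℕ g) B.≈ n B.×ℕ f g
  homo-× zero    g = ε-homo
  homo-× (suc n) g = B.trans (homo g (n A.×ℕ g)) (B.∙-congˡ (homo-× n g))

  homo-· : ∀ z g → f (z A.· g) B.≈ z B.· f g
  homo-· (+ n)    g = homo-× n g
  homo-· -[1+ n ] g = B.trans (⁻¹-homo _) (B.⁻¹-cong (homo-× (suc n) g))

module TorsionFreeGroup (G : AbGroup) (torsionFree : TorsionFree G) where
  open IntegerMultiples G public

  ×-cancel : ∀ k {g h} → suc k ×ℕ g ≈ suc k ×ℕ h → g ≈ h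
  ×-cancel k {g} {h} e = x∙y⁻¹≈ε⇒x≈y g h (torsionFree (suc k) (g ∙ h ⁻¹) (λ ()) (begin
    suc k ×ℕ (g ∙ h ⁻¹)            ≈⟨ ×-distrib-+ g (h ⁻¹) (suc k) ⟩
    suc k ×ℕ g ∙ suc k ×ℕ (h ⁻¹)   ≈⟨ ∙-congˡ (·-⁻¹ (+ suc k) h) ⟩
    suc k ×ℕ g ∙ (suc k ×ℕ h) ⁻¹   ≈⟨ x≈y⇒x∙y⁻¹≈ε e ⟩
    ε                              ∎))

  ·-torsionFree : ∀ z g → z · g ≈ ε → z ≢ + 0 → g ≈ ε
  ·-torsionFree (+ zero)    g e z≢0 = ⊥-elim (z≢0 P.refl)
  ·-torsionFree (+ suc n)   g e _   = torsionFree (suc n) g (λ ()) e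
  ·-torsionFree -[1+ n ]    g e _   =
    torsionFree (suc n) g (λ ()) (trans (sym (⁻¹-involutive _)) (trans (⁻¹-cong e) ε⁻¹≈ε))

  module Coordinates (b : Carrier) (b≉ε : ¬ b ≈ ε) where

    ·-cancelʳ : ∀ z w → z · b ≈ w · b → z ≡ w
    ·-cancelʳ z w e with z ℤ.- w ℤ.≟ + 0
    ... | yes z-w≡0 = ℤP.i-j≡0⇒i≡j z w z-w≡0
    ... | no  z-w≢0 = ⊥-elim (b≉ε (·-torsionFree (z ℤ.- w) b (begin
      (z ℤ.- w) · b          ≈⟨ ·-homo-+ z (ℤ.- w) b ⟩
      z · b ∙ (ℤ.- w) · b    ≈⟨ ∙-congˡ (·-homo-neg w b) ⟩
      z · b ∙ (w · b) ⁻¹     ≈⟨ x≈y⇒x∙y⁻¹≈ε e ⟩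
      ε                      ∎) z-w≢0))

    -- r = q · b; a record, so that q can be inferred from a proof
    record Coordinate (r : Carrier) (q : ℚᵘ) : Set where
      constructor mkCoordinate
      field scaled : ↧ₙ q ×ℕ r ≈ (↥ q) · b

    coordinate-unique : ∀ {r p q} → Coordinate r p → Coordinate r q → p ≃ q
    coordinate-unique {r} {mkℚᵘ u v} {mkℚᵘ u′ v′} (mkCoordinate e) (mkCoordinate e′) =
      *≡* (P.trans (ℤP.*-comm u (+ suc v′)) (P.trans (·-cancelʳ _ _ cross) (ℤP.*-comm (+ suc v) u′)))
      where
      cross : (+ suc v′ ℤ.* u) · b ≈ (+ suc v ℤ.* u′) · b
      cross = begin
        (+ suc v′ ℤ.* u) · b       ≈⟨ ·-*ℕ (suc v′) u b ⟩
        suc v′ ×ℕ (u · b)          ≈⟨ ×-congʳ (suc v′) (sym e) ⟩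
        suc v′ ×ℕ (suc v ×ℕ r)     ≈⟨ ×-swap (suc v′) (suc v) r ⟩
        suc v ×ℕ (suc v′ ×ℕ r)     ≈⟨ ×-congʳ (suc v) e′ ⟩
        suc v ×ℕ (u′ · b)          ≈⟨ sym (·-*ℕ (suc v) u′ b) ⟩
        (+ suc v ℤ.* u′) · b       ∎

    coordinate-resp-≃ : ∀ {r p q} → p ≃ q → Coordinate r p → Coordinate r q
    coordinate-resp-≃ {r} {mkℚᵘ u v} {mkℚᵘ u′ v′} (*≡* uv′≡u′v) (mkCoordinate e) =
      mkCoordinate (×-cancel v (begin
      suc v ×ℕ (suc v′ ×ℕ r)   ≈⟨ ×-swap (suc v) (suc v′) r ⟩
      suc v′ ×ℕ (suc v ×ℕ r)   ≈⟨ ×-congʳ (suc v′) e ⟩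
      suc v′ ×ℕ (u · b)        ≈⟨ sym (·-*ℕ (suc v′) u b) ⟩
      (+ suc v′ ℤ.* u) · b     ≡⟨ P.cong (_· b) (P.trans (ℤP.*-comm (+ suc v′) u)
                                    (P.trans uv′≡u′v (ℤP.*-comm u′ (+ suc v)))) ⟩
      (+ suc v ℤ.* u′) · b     ≈⟨ ·-*ℕ (suc v) u′ b ⟩
      suc v ×ℕ (u′ · b)        ∎))

    coordinate-injective : ∀ {r r′ q} → Coordinate r q → Coordinate r′ q → r ≈ r′
    coordinate-injective {q = mkℚᵘ u v} (mkCoordinate e) (mkCoordinate e′) = ×-cancel v (trans e (sym e′))

    coordinate-resp-≈ : ∀ {r r′ q} → r ≈ r′ → Coordinate r q → Coordinate r′ q
    coordinate-resp-≈ {q = mkℚᵘ u v} r≈r′ (mkCoordinate e) =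
      mkCoordinate (trans (×-congʳ (suc v) (sym r≈r′)) e)

    coordinate-ε : Coordinate ε 0ℚᵘ
    coordinate-ε = mkCoordinate (identityʳ ε)

    coordinate-⁻¹ : ∀ {r q} → Coordinate r q → Coordinate (r ⁻¹) (Q.- q)
    coordinate-⁻¹ {r} {mkℚᵘ u v} (mkCoordinate e) =
      mkCoordinate (trans (·-⁻¹ (+ suc v) r) (trans (⁻¹-cong e) (sym (·-homo-neg u b))))

    coordinate-∙ : ∀ {r r′ p q} → Coordinate r p → Coordinate r′ q → Coordinate (r ∙ r′) (p Q.+ q)
    coordinate-∙ {r} {r′} {mkℚᵘ u v} {mkℚᵘ u′ v′} (mkCoordinate e) (mkCoordinate e′) =
      mkCoordinate (begin
      (suc v ℕ.* suc v′) ×ℕ (r ∙ r′)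
        ≈⟨ ×-distrib-+ r r′ (suc v ℕ.* suc v′) ⟩
      (suc v ℕ.* suc v′) ×ℕ r ∙ (suc v ℕ.* suc v′) ×ℕ r′
        ≈⟨ ∙-cong (×-congˡ (ℕP.*-comm (suc v) (suc v′))) refl ⟩
      (suc v′ ℕ.* suc v) ×ℕ r ∙ (suc v ℕ.* suc v′) ×ℕ r′
        ≈⟨ ∙-cong (sym (×-assocˡ r (suc v′) (suc v))) (sym (×-assocˡ r′ (suc v) (suc v′))) ⟩
      suc v′ ×ℕ (suc v ×ℕ r) ∙ suc v ×ℕ (suc v′ ×ℕ r′)
        ≈⟨ ∙-cong (×-congʳ (suc v′) e) (×-congʳ (suc v) e′) ⟩
      suc v′ ×ℕ (u · b) ∙ suc v ×ℕ (u′ · b)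
        ≈⟨ ∙-cong (sym (·-*ℕ (suc v′) u b)) (sym (·-*ℕ (suc v) u′ b)) ⟩
      (+ suc v′ ℤ.* u) · b ∙ (+ suc v ℤ.* u′) · b
        ≈⟨ sym (·-homo-+ (+ suc v′ ℤ.* u) (+ suc v ℤ.* u′) b) ⟩
      (+ suc v′ ℤ.* u ℤ.+ + suc v ℤ.* u′) · b
        ≡⟨ P.cong₂ (λ x y → (x ℤ.+ y) · b) (ℤP.*-comm (+ suc v′) u) (ℤP.*-comm (+ suc v) u′) ⟩
      (u ℤ.* + suc v′ ℤ.+ u′ ℤ.* + suc v) · b
        ∎)

    coordinate⇒divisible : ∀ {r u v p} → Prime p → Coordinate r (mkℚᵘ u v) → p ∣ suc v → ¬ p ∣ ∣ u ∣ →
      Σ Carrier λ y → p ×ℕ y ≈ b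
    coordinate⇒divisible {r} {u} {v} {p} p-prime (mkCoordinate e) (divides m v≡mp) p∤u
      with invertibleModulo-prime p-prime p∤u
    ... | β , γ , βu+γp≡1 = β · (m ×ℕ r) ∙ γ · b , (begin
      p ×ℕ (β · (m ×ℕ r) ∙ γ · b)          ≈⟨ ×-distrib-+ _ _ p ⟩
      p ×ℕ (β · (m ×ℕ r)) ∙ p ×ℕ (γ · b)   ≈⟨ ∙-cong (·-·-comm (+ p) β (m ×ℕ r)) (sym (·-*ℕ p γ b)) ⟩
      β · (p ×ℕ (m ×ℕ r)) ∙ (+ p ℤ.* γ) · b ≈⟨ ∙-congʳ (·-cong β pm·r≈u·b) ⟩
      β · (u · b) ∙ (+ p ℤ.* γ) · b         ≈⟨ ∙-congʳ (sym (·-assoc β u b)) ⟩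
      (β ℤ.* u) · b ∙ (+ p ℤ.* γ) · b       ≈⟨ sym (·-homo-+ (β ℤ.* u) (+ p ℤ.* γ) b) ⟩
      (β ℤ.* u ℤ.+ + p ℤ.* γ) · b           ≡⟨ P.cong (λ t → (β ℤ.* u ℤ.+ t) · b) (ℤP.*-comm (+ p) γ) ⟩
      (β ℤ.* u ℤ.+ γ ℤ.* + p) · b           ≡⟨ P.cong (_· b) βu+γp≡1 ⟩
      (+ 1) · b                             ≈⟨ ·-identityˡ b ⟩
      b                                     ∎)
      where
      pm·r≈u·b : p ×ℕ (m ×ℕ r) ≈ u · b
      pm·r≈u·b = trans (×-assocˡ r p m) (trans (×-congˡ (P.trans (ℕP.*-comm p m) (P.sym v≡mp))) e)

    coordinate : RankOne G → ∀ r → Σ ℚᵘ (Coordinate r)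
    coordinate (_ , dependent) r with dependent b r
    ... | m , zero , nonzero , inj₁ mb≈0r =
      ⊥-elim (b≉ε (torsionFree m b (λ m≡0 → nonzero (m≡0 , P.refl)) mb≈0r))
    ... | m , zero , nonzero , inj₂ mb+0r≈ε =
      ⊥-elim (b≉ε (torsionFree m b (λ m≡0 → nonzero (m≡0 , P.refl)) (trans (sym (identityʳ _)) mb+0r≈ε)))
    ... | m , suc v , _ , inj₁ mb≈nr = mkℚᵘ (+ m) v , mkCoordinate (sym mb≈nr)
    ... | m , suc v , _ , inj₂ mb+nr≈ε =
      mkℚᵘ (ℤ.- (+ m)) v , mkCoordinate (trans (inverseʳ-unique _ _ mb+nr≈ε) (sym (·-homo-neg (+ m) b)))

module _ {G H : AbGroup} (torsionFreeG : TorsionFree G) (torsionFreeH : TorsionFree H)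
  (rankOneG : RankOne G)
  {g₀ : AbelianGroup.Carrier G} (g₀≉ε : ¬ AbelianGroup._≈_ G g₀ (AbelianGroup.ε G))
  {h₀ : AbelianGroup.Carrier H} (h₀≉ε : ¬ AbelianGroup._≈_ H h₀ (AbelianGroup.ε H)) where
  private
    module G = TorsionFreeGroup G torsionFreeG
    module GC = G.Coordinates g₀ g₀≉ε
    module H = TorsionFreeGroup H torsionFreeH
    module HC = H.Coordinates h₀ h₀≉ε

  coordinate-preserving⇒isHom : (f : G.Carrier → H.Carrier) →
    (∀ {g q} → GC.Coordinate g q → HC.Coordinate (f g) q) → IsHom G H f
  coordinate-preserving⇒isHom f preserves = isHom G H f
    (λ {x} x≈y → HC.coordinate-injective (preserves (coord x))
                                          (preserves (GC.coordinate-resp-≈ x≈y (coord x))))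
    (λ x y → HC.coordinate-injective (preserves (GC.coordinate-∙ (coord x) (coord y)))
                                      (HC.coordinate-∙ (preserves (coord x)) (preserves (coord y))))
    (HC.coordinate-injective (preserves GC.coordinate-ε) HC.coordinate-ε)
    (λ x → HC.coordinate-injective (preserves (GC.coordinate-⁻¹ (coord x)))
                                    (HC.coordinate-⁻¹ (preserves (coord x))))
    where
    coord : ∀ g → GC.Coordinate g (proj₁ (GC.coordinate rankOneG g))
    coord g = proj₂ (GC.coordinate rankOneG g)

extension-torsionFree : ∀ {X E T} → TorsionFree X → TorsionFree T → ShortExact X E T → TorsionFree E
extension-torsionFree {X} {E} {T} torsionFreeX torsionFreeT ses n e n≢0 ne≈ε =
  E.trans e≈ιx (E.trans (ι.⟦⟧-cong x≈ε) ι.ε-homo)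
  where
  open ShortExact ses using (ι; π; ι-hom; π-hom; ι-inj; ker⊆im)
  module X = IntegerMultiples X
  module E = IntegerMultiples E
  module T = IntegerMultiples T
  module ι = HomomorphismProperties {X} {E} ι-hom
  module π = HomomorphismProperties {E} {T} π-hom
  πe≈ε : π e T.≈ T.ε
  πe≈ε = torsionFreeT n (π e) n≢0 (T.trans (T.sym (π.homo-× n e)) (T.trans (π.⟦⟧-cong ne≈ε) π.ε-homo))
  x : X.Carrier
  x = proj₁ (ker⊆im e πe≈ε)
  e≈ιx : e E.≈ ι x
  e≈ιx = E.sym (proj₂ (ker⊆im e πe≈ε))
  x≈ε : x X.≈ X.ε
  x≈ε = torsionFreeX n x n≢0 (ι-inj (n X.×ℕ x) X.ε
          (E.trans (ι.homo-× n x) (E.trans (E.×-congʳ n (E.sym e≈ιx)) (E.trans ne≈ε (E.sym ι.ε-homo)))))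

-- The group X ⊆ ℚ

ℚ-group : AbGroup
ℚ-group = QP.+-0-abelianGroup

module ℚᴳ = IntegerMultiples ℚ-group

×≃* : ∀ n q → n ℚᴳ.×ℕ q ≃ q Q.* mkℚᵘ (+ n) 0
×≃* zero    q = QP.≃-sym (QP.*-zeroʳ q)
×≃* (suc n) q = QP.≃-trans (QP.+-cong (QP.≃-sym (QP.*-identityʳ q)) (×≃* n q))
  (QP.≃-trans (QP.≃-sym (QP.*-distribˡ-+ q 1ℚᵘ (mkℚᵘ (+ n) 0))) (QP.*-congˡ {q} (*≡* (1+n (+ n)))))
  where
  1+n : ∀ n → (+ 1 ℤ.* + 1 ℤ.+ n ℤ.* + 1) ℤ.* + 1 ≡ (+ 1 ℤ.+ n) ℤ.* (+ 1 ℤ.* + 1)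
  1+n = solve-∀

×≃⇒≃*1/ : ∀ y l k → suc k ℚᴳ.×ℕ y ≃ l → y ≃ l Q.* mkℚᵘ (+ 1) k
×≃⇒≃*1/ y l k ky≃l = QP.≃-sym (begin
  l Q.* mkℚᵘ (+ 1) k                             ≈⟨ QP.*-congʳ (QP.≃-trans (QP.≃-sym ky≃l) (×≃* (suc k) y)) ⟩
  y Q.* mkℚᵘ (+ suc k) 0 Q.* mkℚᵘ (+ 1) k        ≈⟨ QP.*-assoc y (mkℚᵘ (+ suc k) 0) (mkℚᵘ (+ 1) k) ⟩
  y Q.* (mkℚᵘ (+ suc k) 0 Q.* mkℚᵘ (+ 1) k)      ≈⟨ QP.*-congˡ {y} k*1/k≃1 ⟩
  y Q.* 1ℚᵘ                                      ≈⟨ QP.*-identityʳ y ⟩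
  y                                              ∎)
  where
  open SetoidReasoning QP.≃-setoid
  k*1/k≃1 : mkℚᵘ (+ suc k) 0 Q.* mkℚᵘ (+ 1) k ≃ 1ℚᵘ
  k*1/k≃1 = *≡* (P.trans (ℤP.*-identityʳ _) (P.trans (ℤP.*-identityʳ (+ suc k))
    (P.trans (P.cong +_ (P.sym (ℕP.*-identityˡ (suc k)))) (P.sym (ℤP.*-identityˡ (+ (1 ℕ.* suc k)))))))

-‿+-interchange : ∀ a b c d → (a Q.+ b) Q.- (c Q.+ d) ≃ (a Q.- c) Q.+ (b Q.- d)
-‿+-interchange a b c d = QP.≃-trans (QP.+-congʳ (a Q.+ b) (QP.≃-sym (ℚᴳ.⁻¹-∙-comm c d)))
                                     (ℚᴳ.interchange a b (Q.- c) (Q.- d))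

-‿≃0 : ∀ q {z} → z ≃ 0ℚᵘ → q Q.- z ≃ q
-‿≃0 q z≃0 = QP.≃-trans (QP.+-congʳ q (QP.-‿cong z≃0)) (QP.+-identityʳ q)

ℚ-torsionFree : TorsionFree ℚ-group
ℚ-torsionFree zero    _           0≢0 _  = ⊥-elim (0≢0 P.refl)
ℚ-torsionFree (suc n) (mkℚᵘ a d) _   na≃0 with QP.≃-trans (QP.≃-sym (×≃* (suc n) (mkℚᵘ a d))) na≃0
... | *≡* an≡0 with ℤP.i*j≡0⇒i≡0∨j≡0 a
      (P.trans (P.sym (ℤP.*-identityʳ (a ℤ.* + suc n))) (P.trans an≡0 (ℤP.*-zeroˡ (+ (suc d ℕ.* 1)))))
...   | inj₁ P.refl = *≡* P.refl
...   | inj₂ ()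

∣∣-cross : ∀ x y → + ∣ y ∣ ℤ.* x ≡ + ∣ x ∣ ℤ.* y ⊎ + ∣ y ∣ ℤ.* x ℤ.+ + ∣ x ∣ ℤ.* y ≡ + 0
∣∣-cross (+ m)    (+ n)    = inj₁ (ℤP.*-comm (+ n) (+ m))
∣∣-cross (+ m)    -[1+ n ] = inj₂ (cancel (+ m) (+ suc n))
  where
  cancel : ∀ m n → n ℤ.* m ℤ.+ m ℤ.* (ℤ.- n) ≡ + 0
  cancel = solve-∀
∣∣-cross -[1+ m ] (+ n)    = inj₂ (cancel (+ suc m) (+ n))
  where
  cancel : ∀ m n → n ℤ.* (ℤ.- m) ℤ.+ m ℤ.* n ≡ + 0
  cancel = solve-∀
∣∣-cross -[1+ m ] -[1+ n ] = inj₁ (swap (+ suc m) (+ suc n))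
  where
  swap : ∀ m n → n ℤ.* (ℤ.- m) ≡ m ℤ.* (ℤ.- n)
  swap = solve-∀

ℚ-rankOne : RankOne ℚ-group
ℚ-rankOne = (1ℚᵘ , λ { (*≡* ()) }) , dependent
  where
  dependent≢0 : ∀ x dx y dy → y ≢ + 0 → Dependent ℚ-group (mkℚᵘ x dx) (mkℚᵘ y dy)
  dependent≢0 x dx y dy y≢0 = ∣ y ∣ ℕ.* suc dx , ∣ x ∣ ℕ.* suc dy , nontrivial ,
    Sum.map (λ e → QP.≃-trans mx≃∣y∣x (QP.≃-trans (QP.≃-reflexive (P.cong (λ t → mkℚᵘ t 0) e))
                                                   (QP.≃-sym ny≃∣x∣y)))
            (λ e → QP.≃-trans (QP.+-cong mx≃∣y∣x ny≃∣x∣y)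
                     (QP.≃-trans (+-same-denominator (+ ∣ y ∣ ℤ.* x) (+ ∣ x ∣ ℤ.* y) 0)
                                 (QP.≃-reflexive (P.cong (λ t → mkℚᵘ t 0) e))))
            (∣∣-cross x y)
    where
    nontrivial : ¬ (∣ y ∣ ℕ.* suc dx ≡ 0 × ∣ x ∣ ℕ.* suc dy ≡ 0)
    nontrivial (m≡0 , _) with ℕP.m*n≡0⇒m≡0∨n≡0 ∣ y ∣ m≡0
    ... | inj₁ ∣y∣≡0 = y≢0 (ℤP.∣i∣≡0⇒i≡0 ∣y∣≡0)
    mx≃∣y∣x : (∣ y ∣ ℕ.* suc dx) ℚᴳ.×ℕ mkℚᵘ x dx ≃ mkℚᵘ (+ ∣ y ∣ ℤ.* x) 0
    mx≃∣y∣x = QP.≃-trans (×≃* (∣ y ∣ ℕ.* suc dx) (mkℚᵘ x dx)) (*-clear-denominator ∣ y ∣ x dx)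
    ny≃∣x∣y : (∣ x ∣ ℕ.* suc dy) ℚᴳ.×ℕ mkℚᵘ y dy ≃ mkℚᵘ (+ ∣ x ∣ ℤ.* y) 0
    ny≃∣x∣y = QP.≃-trans (×≃* (∣ x ∣ ℕ.* suc dy) (mkℚᵘ y dy)) (*-clear-denominator ∣ x ∣ y dy)
  dependent : ∀ p q → Dependent ℚ-group p q
  dependent p (mkℚᵘ (+ zero) d) = 0 , 1 , (λ { (_ , ()) }) ,
    inj₁ (QP.≃-sym (QP.≃-trans (QP.+-identityʳ (mkℚᵘ (+ 0) d)) (*≡* P.refl)))
  dependent (mkℚᵘ x dx) (mkℚᵘ y@(+ suc _) dy) = dependent≢0 x dx y dy (λ ())
  dependent (mkℚᵘ x dx) (mkℚᵘ y@(-[1+ _ ]) dy) = dependent≢0 x dx y dy (λ ())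

module PrimeSequence (s : ℕ → ℕ) (s-prime : ∀ i → Prime (s i)) where

  IntegralAtAll : ℚᵘ → Set
  IntegralAtAll q = ∀ i → Integral (s i) q

  private
    module Xˢ = Subgroup ℚ-group IntegralAtAll
      (λ p q i → integral-+ (s-prime i) (p i) (q i))
      (λ i → integral-0 (s-prime i))
      (λ p i → integral-neg (p i))

  X : AbGroup
  X = Xˢ.subgroup

  module Xᴳ = IntegerMultiples X

  X-rankOneTorsionFree : RankOneTorsionFree X
  X-rankOneTorsionFree = Xˢ.subgroup-torsionFree ℚ-torsionFree ,
    Xˢ.subgroup-rankOne ℚ-rankOne ((1ℚᵘ , λ i → integral-ℤ (s-prime i) (+ 1)) , λ { (*≡* ()) })

  divide : Xᴳ.Carrier → (v : ℕ) → (∀ i → ¬ s i ∣ suc v) → Xᴳ.Carrier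
  divide (q , q∈X) v s∤v = q Q.* mkℚᵘ (+ 1) v ,
    λ i → integral-* (s-prime i) (q∈X i) (integral-mkℚᵘ (s-prime i) (+ 1) v (s∤v i))

  ×-divide : ∀ x v s∤v → suc v Xᴳ.×ℕ divide x v s∤v Xᴳ.≈ x
  ×-divide (mkℚᵘ n d , n/d∈X) v s∤v =
    QP.≃-trans (Xˢ.×-proj₁ (suc v) (divide (mkℚᵘ n d , n/d∈X) v s∤v)) (QP.≃-trans (×≃* (suc v) _)
      (*≡* (P.trans (rearrange n (+ suc d) (+ suc v))
        (P.cong (n ℤ.*_) (P.trans (P.cong (ℤ._* + 1) (P.sym (ℤP.pos-* (suc d) (suc v))))
                                  (P.sym (ℤP.pos-* (suc d ℕ.* suc v) 1)))))))
    where
    rearrange : ∀ n d v → ((n ℤ.* + 1) ℤ.* v) ℤ.* d ≡ n ℤ.* ((d ℤ.* v) ℤ.* + 1)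
    rearrange = solve-∀

module IncreasingPrimeSequence (s : ℕ → ℕ) (s-prime : ∀ i → Prime (s i))
  (s-increasing : ∀ i → s i < s (suc i)) where

  s-strictMono : ∀ {i j} → i < j → s i < s j
  s-strictMono {i} {suc j} (s≤s i≤j) with ℕP.m≤n⇒m<n∨m≡n i≤j
  ... | inj₁ i<j    = ℕP.<-trans (s-strictMono i<j) (s-increasing j)
  ... | inj₂ P.refl = s-increasing j

  i<s : ∀ i → i < s i
  i<s zero    = ℕP.<-trans (s≤s z≤n) (prime⇒1< (s-prime 0))
  i<s (suc i) = ℕP.≤-trans (s≤s (i<s i)) (s-increasing i)

  Interpolates : (ℕ → ℤ) → ℕ → ℤ → ℕ → Set
  Interpolates S d z j = ∀ i → i < j → Integral (s i) (mkℚᵘ (z ℤ.- S i) d)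

  chinese-remainder-step : ∀ S d j z → Interpolates S d z j → Σ ℤ λ z′ → Interpolates S d z′ (suc j)
  chinese-remainder-step S d j z z-ok
    with factor-out (s j) (prime⇒1< (s-prime j)) d
  ... | k , w , d≡s^kw , s∤w
    with invertibleModulo-^ (s-prime j) s∤w k | suc≡*⇒nonzero (s j ^ k) (suc w) d d≡s^kw
  ... | β , γ , βw+γs^k≡1 | e , s^k≡1+e = z′ , z′-ok
    where
    -- As 1 + d = s j ^ k (1 + w), the correction n β (1 + w) / (1 + d) = n β / s j ^ k is integral
    -- away from s j, while β (1 + w) ≡ 1 modulo s j ^ k makes z′ ≡ S j there.
    n z′ : ℤ
    n = S j ℤ.- z
    z′ = z ℤ.+ n ℤ.* β ℤ.* + suc w

    z′-S≡ : z′ ℤ.- S j ≡ (ℤ.- (n ℤ.* γ)) ℤ.* + (s j ^ k)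
    z′-S≡ = P.trans (expand z (S j) β γ (+ suc w) (+ (s j ^ k)))
              (P.trans (P.cong (λ t → (ℤ.- (n ℤ.* γ)) ℤ.* + (s j ^ k) ℤ.+ n ℤ.* (t ℤ.- + 1)) βw+γs^k≡1)
                       (collapse _ n))
      where
      expand : ∀ z S β γ W P → z ℤ.+ (S ℤ.- z) ℤ.* β ℤ.* W ℤ.- S
             ≡ (ℤ.- ((S ℤ.- z) ℤ.* γ)) ℤ.* P ℤ.+ (S ℤ.- z) ℤ.* (β ℤ.* W ℤ.+ γ ℤ.* P ℤ.- + 1)
      expand = solve-∀
      collapse : ∀ x n → x ℤ.+ n ℤ.* (+ 1 ℤ.- + 1) ≡ x
      collapse = solve-∀

    z′-S≡z-S+ : ∀ i → mkℚᵘ (z′ ℤ.- S i) d ≃ mkℚᵘ (z ℤ.- S i) d Q.+ mkℚᵘ (n ℤ.* β) e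
    z′-S≡z-S+ i = QP.≃-trans (QP.≃-reflexive (P.cong (λ t → mkℚᵘ t d) (shift z (S i) (n ℤ.* β) (+ suc w))))
      (QP.≃-trans (QP.≃-sym (+-same-denominator (z ℤ.- S i) (n ℤ.* β ℤ.* + suc w) d))
        (QP.+-congʳ (mkℚᵘ (z ℤ.- S i) d) (*-cancel-denominator (n ℤ.* β) (suc w) d e
          (P.trans d≡s^kw (P.trans (P.cong (ℕ._* suc w) s^k≡1+e) (ℕP.*-comm (suc e) (suc w)))))))
      where
      shift : ∀ z S x W → z ℤ.+ x ℤ.* W ℤ.- S ≡ (z ℤ.- S) ℤ.+ x ℤ.* W
      shift = solve-∀

    z′-ok : Interpolates S d z′ (suc j)
    z′-ok i (s≤s i≤j) with ℕP.m≤n⇒m<n∨m≡n i≤j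
    ... | inj₂ P.refl = integral-resp-≃
          (QP.≃-sym (QP.≃-trans (QP.≃-reflexive (P.cong (λ t → mkℚᵘ t d) z′-S≡))
                                (*-cancel-denominator (ℤ.- (n ℤ.* γ)) (s j ^ k) d w d≡s^kw)))
          (integral-mkℚᵘ (s-prime j) _ w s∤w)
    ... | inj₁ i<j = integral-resp-≃ (QP.≃-sym (z′-S≡z-S+ i))
          (integral-+ (s-prime i) (z-ok i i<j) (integral-mkℚᵘ (s-prime i) (n ℤ.* β) e s∤s^k))
      where
      s∤s^k : ¬ s i ∣ suc e
      s∤s^k s∣s^k = ℕP.<⇒≢ (s-strictMono i<j)
        (prime∣p^k⇒≡p (s-prime j) (s-prime i) k (P.subst (s i ∣_) (P.sym s^k≡1+e) s∣s^k))

  chinese-remainder : (S : ℕ → ℤ) (d : ℕ) → Σ ℤ λ z → ∀ i → Integral (s i) (mkℚᵘ (z ℤ.- S i) d)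
  chinese-remainder S d = z , z-ok
    where
    upTo : ∀ j → Σ ℤ λ z → Interpolates S d z j
    upTo zero    = + 0 , λ i ()
    upTo (suc j) = chinese-remainder-step S d j (proj₁ (upTo j)) (proj₂ (upTo j))
    z : ℤ
    z = proj₁ (upTo (suc d))
    z-ok : ∀ i → Integral (s i) (mkℚᵘ (z ℤ.- S i) d)
    z-ok i with i ℕP.<? suc d
    ... | yes i<d = proj₂ (upTo (suc d)) i i<d
    ... | no  i≮d = integral-mkℚᵘ (s-prime i) _ d
                      (λ s∣d → ℕP.<⇒≱ (ℕP.≤-trans (ℕP.≰⇒> i≮d) (i<s i)) (∣⇒≤ s∣d))

-- Ext(T, X) = 0

module ExtVanishing (s : ℕ → ℕ) (s-prime : ∀ i → Prime (s i))
  (T : AbGroup) (torsionFreeT : TorsionFree T) (rankOneT : RankOne T)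
  (a : AbelianGroup.Carrier T) (a≉ε : ¬ AbelianGroup._≈_ T a (AbelianGroup.ε T))
  (a-indivisible : ∀ i → ¬ DivIn T (s i) a) where
  open PrimeSequence s s-prime
  module T = TorsionFreeGroup T torsionFreeT
  module TC = T.Coordinates a a≉ε

  reduced-coordinate : ∀ t → Σ ℤ λ u → Σ ℕ λ v → TC.Coordinate t (mkℚᵘ u v) × (∀ i → ¬ s i ∣ suc v)
  reduced-coordinate t = reduce (ℚ.fromℚᵘ q) (TC.coordinate-resp-≃ (QP.≃-sym (ℚP.toℚᵘ-fromℚᵘ q)) t-q)
    where
    q : ℚᵘ
    q = proj₁ (TC.coordinate rankOneT t)
    t-q : TC.Coordinate t q
    t-q = proj₂ (TC.coordinate rankOneT t)
    reduce : (p : ℚ.ℚ) → TC.Coordinate t (ℚ.toℚᵘ p) →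
      Σ ℤ λ u → Σ ℕ λ v → TC.Coordinate t (mkℚᵘ u v) × (∀ i → ¬ s i ∣ suc v)
    reduce (ℚ.mkℚ u v coprime) t-u/v = u , v , t-u/v , λ i s∣v →
      a-indivisible i (TC.coordinate⇒divisible (s-prime i) t-u/v s∣v λ s∣u →
        prime∤1 (s-prime i) (P.subst (s i ∣_) (Coprimality.recompute coprime (s∣u , s∣v)) ∣-refl))

  module Splitting (E : AbGroup) (ses : ShortExact X E T) where
    open ShortExact ses using (ι; π; ι-hom; π-hom; π-surj; πι≈0; ker⊆im)
    module ι = HomomorphismProperties {X} {E} ι-hom
    module π = HomomorphismProperties {E} {T} π-hom

    torsionFreeE : TorsionFree E
    torsionFreeE = extension-torsionFree (proj₁ X-rankOneTorsionFree) torsionFreeT ses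

    module E = TorsionFreeGroup E torsionFreeE

    e₀ : E.Carrier
    e₀ = proj₁ (π-surj a)

    e₀≉ε : ¬ e₀ E.≈ E.ε
    e₀≉ε e₀≈ε = a≉ε (T.trans (T.sym (proj₂ (π-surj a))) (T.trans (π.⟦⟧-cong e₀≈ε) π.ε-homo))

    module EC = E.Coordinates e₀ e₀≉ε

    module Lift (t : T.Carrier) where
      u : ℤ
      u = proj₁ (reduced-coordinate t)
      v : ℕ
      v = proj₁ (proj₂ (reduced-coordinate t))
      t-u/v : TC.Coordinate t (mkℚᵘ u v)
      t-u/v = proj₁ (proj₂ (proj₂ (reduced-coordinate t)))
      s∤v : ∀ i → ¬ s i ∣ suc v
      s∤v = proj₂ (proj₂ (proj₂ (reduced-coordinate t)))
      e : E.Carrier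
      e = proj₁ (π-surj t)

      -- (v + 1) e − u e₀ lies in ι X, and X is divisible by v + 1
      d : E.Carrier
      d = suc v E.×ℕ e E.∙ (u E.· e₀) E.⁻¹

      πd≈ε : π d T.≈ T.ε
      πd≈ε = T.trans (π.homo _ _) (T.trans (T.∙-cong
        (T.trans (π.homo-× (suc v) e) (T.×-congʳ (suc v) (proj₂ (π-surj t))))
        (T.trans (π.⁻¹-homo _) (T.⁻¹-cong (T.trans (π.homo-· u e₀) (T.·-cong u (proj₂ (π-surj a)))))))
        (T.x≈y⇒x∙y⁻¹≈ε (TC.Coordinate.scaled t-u/v)))

      x : Xᴳ.Carrier
      x = proj₁ (ker⊆im d πd≈ε)

      σt : E.Carrier
      σt = e E.∙ ι (divide x v s∤v) E.⁻¹

      σt-coordinate : EC.Coordinate σt (mkℚᵘ u v)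
      σt-coordinate = EC.mkCoordinate (begin
        suc v ×ℕ (e ∙ ι (divide x v s∤v) ⁻¹)           ≈⟨ ×-distrib-+ e _ (suc v) ⟩
        suc v ×ℕ e ∙ suc v ×ℕ (ι (divide x v s∤v) ⁻¹)   ≈⟨ ∙-congˡ (·-⁻¹ (+ suc v) _) ⟩
        suc v ×ℕ e ∙ (suc v ×ℕ ι (divide x v s∤v)) ⁻¹   ≈⟨ ∙-congˡ (⁻¹-cong (sym (ι.homo-× (suc v) _))) ⟩
        suc v ×ℕ e ∙ ι (suc v Xᴳ.×ℕ divide x v s∤v) ⁻¹  ≈⟨ ∙-congˡ (⁻¹-cong (ι.⟦⟧-cong (×-divide x v s∤v))) ⟩
        suc v ×ℕ e ∙ ι x ⁻¹                             ≈⟨ ∙-congˡ (⁻¹-cong (proj₂ (ker⊆im d πd≈ε))) ⟩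
        suc v ×ℕ e ∙ d ⁻¹                               ≈⟨ ∙-congˡ (⁻¹-anti-homo‿- _ _) ⟩
        suc v ×ℕ e ∙ (u · e₀ ∙ (suc v ×ℕ e) ⁻¹)         ≈⟨ sym (assoc _ _ _) ⟩
        suc v ×ℕ e ∙ u · e₀ ∙ (suc v ×ℕ e) ⁻¹           ≈⟨ xyx⁻¹≈y _ _ ⟩
        u · e₀                                          ∎)
        where open E

      π-σt : π σt T.≈ t
      π-σt = T.trans (π.homo _ _) (T.trans (T.∙-cong (proj₂ (π-surj t))
        (T.trans (π.⁻¹-homo _) (T.trans (T.⁻¹-cong (πι≈0 _)) T.ε⁻¹≈ε))) (T.identityʳ t))

    σ : T.Carrier → E.Carrier
    σ = Lift.σt

    σ-preserves-coordinates : ∀ {t q} → TC.Coordinate t q → EC.Coordinate (σ t) q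
    σ-preserves-coordinates {t} t-q =
      EC.coordinate-resp-≃ (TC.coordinate-unique (Lift.t-u/v t) t-q) (Lift.σt-coordinate t)

    splits : Splits ses
    splits = σ
           , coordinate-preserving⇒isHom torsionFreeT torsionFreeE rankOneT a≉ε e₀≉ε σ σ-preserves-coordinates
           , Lift.π-σt

  Ext-vanishes : ExtZero T X
  Ext-vanishes = Splitting.splits

-- Ext(R, X) ≠ 0

select : Parity → ℚᵘ → ℚᵘ
select 0ℙ _ = 0ℚᵘ
select 1ℙ q = q

selectℤ : Parity → ℤ → ℤ
selectℤ 0ℙ _ = + 0
selectℤ 1ℙ u = u

select-mkℚᵘ : ∀ π u d → select π (mkℚᵘ u d) ≃ mkℚᵘ (selectℤ π u) d
select-mkℚᵘ 0ℙ u d = *≡* (P.trans (ℤP.*-zeroˡ (+ suc d)) (P.sym (ℤP.*-zeroˡ (+ 1))))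
select-mkℚᵘ 1ℙ u d = QP.≃-refl

select-resp-≃ : ∀ π {p q} → p ≃ q → select π p ≃ select π q
select-resp-≃ 0ℙ _   = QP.≃-refl
select-resp-≃ 1ℙ p≃q = p≃q

select-0 : ∀ π → select π 0ℚᵘ ≃ 0ℚᵘ
select-0 0ℙ = QP.≃-refl
select-0 1ℙ = QP.≃-refl

select-+ : ∀ π p q → select π (p Q.+ q) ≃ select π p Q.+ select π q
select-+ 0ℙ p q = QP.≃-sym (QP.+-identityˡ 0ℚᵘ)
select-+ 1ℙ p q = QP.≃-refl

select-neg : ∀ π q → select π (Q.- q) ≃ Q.- select π q
select-neg 0ℙ q = QP.≃-refl
select-neg 1ℙ q = QP.≃-refl

module ExtNonvanishing (s : ℕ → ℕ) (s-prime : ∀ i → Prime (s i)) (s-increasing : ∀ i → s i < s (suc i))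
  (R : AbGroup) (torsionFreeR : TorsionFree R) (rankOneR : RankOne R)
  (b : AbelianGroup.Carrier R) (b≉ε : ¬ AbelianGroup._≈_ R b (AbelianGroup.ε R))
  (b-divisible : ∀ i → DivIn R (s i) b) where
  open PrimeSequence s s-prime
  open IncreasingPrimeSequence s s-prime s-increasing
  module R = TorsionFreeGroup R torsionFreeR
  module RC = R.Coordinates b b≉ε

  R×ℚ : AbGroup
  R×ℚ = DirectProduct.abelianGroup R ℚ-group

  Admissible : R.Carrier × ℚᵘ → Set
  Admissible (r , y) = ∀ {q} → RC.Coordinate r q → ∀ i → Integral (s i) (y Q.- select (parity i) q)

  admissible : ∀ {r} y {q} → RC.Coordinate r q → (∀ i → Integral (s i) (y Q.- select (parity i) q)) →
    Admissible (r , y)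
  admissible y r-q y-ok r-q′ i = integral-resp-≃
    (QP.+-congʳ y (QP.-‿cong (select-resp-≃ (parity i) (RC.coordinate-unique r-q r-q′)))) (y-ok i)

  coordinate-of : ∀ r → RC.Coordinate r (proj₁ (RC.coordinate rankOneR r))
  coordinate-of r = proj₂ (RC.coordinate rankOneR r)

  admissible-∙ : ∀ {x y} → Admissible x → Admissible y → Admissible (AbelianGroup._∙_ R×ℚ x y)
  admissible-∙ {r , y} {r′ , y′} x-ok y-ok =
    admissible (y Q.+ y′) (RC.coordinate-∙ (coordinate-of r) (coordinate-of r′))
    λ i → integral-resp-≃
      (QP.≃-sym (QP.≃-trans (QP.+-congʳ (y Q.+ y′) (QP.-‿cong (select-+ (parity i) _ _)))
                            (-‿+-interchange y y′ _ _)))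
      (integral-+ (s-prime i) (x-ok (coordinate-of r) i) (y-ok (coordinate-of r′) i))

  admissible-ε : Admissible (AbelianGroup.ε R×ℚ)
  admissible-ε = admissible 0ℚᵘ RC.coordinate-ε λ i →
    integral-resp-≃ (QP.≃-sym (-‿≃0 0ℚᵘ (select-0 (parity i)))) (integral-0 (s-prime i))

  admissible-⁻¹ : ∀ {x} → Admissible x → Admissible (AbelianGroup._⁻¹ R×ℚ x)
  admissible-⁻¹ {r , y} x-ok = admissible (Q.- y) (RC.coordinate-⁻¹ (coordinate-of r)) λ i →
    integral-resp-≃ (QP.≃-trans (QP.≃-sym (ℚᴳ.⁻¹-∙-comm y _))
                                (QP.+-congʳ (Q.- y) (QP.-‿cong (QP.≃-sym (select-neg (parity i) _)))))
      (integral-neg (x-ok (coordinate-of r) i))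

  open Subgroup R×ℚ Admissible (λ {x} {y} → admissible-∙ {x} {y}) admissible-ε (λ {x} → admissible-⁻¹ {x})
    using (×-proj₁) renaming (subgroup to E)

  module E = IntegerMultiples E

  ι : Xᴳ.Carrier → E.Carrier
  ι (q , q∈X) = (R.ε , q) , admissible q RC.coordinate-ε
    λ i → integral-resp-≃ (QP.≃-sym (-‿≃0 q (select-0 (parity i)))) (q∈X i)

  π : E.Carrier → R.Carrier
  π ((r , _) , _) = r

  π-surjective : ∀ r → Σ E.Carrier λ e → π e R.≈ r
  π-surjective r = lift (coordinate-of r)
    where
    lift : ∀ {q} → RC.Coordinate r q → Σ E.Carrier λ e → π e R.≈ r
    lift {mkℚᵘ u v} r-u/v with chinese-remainder (λ i → selectℤ (parity i) u) v
    ... | z , z-ok = ((r , mkℚᵘ z v) , admissible (mkℚᵘ z v) r-u/v λ i → integral-resp-≃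
          (QP.≃-sym (QP.≃-trans (QP.+-congʳ (mkℚᵘ z v) (QP.-‿cong (select-mkℚᵘ (parity i) u v)))
                                (+-same-denominator z _ v)))
          (z-ok i)) , R.refl

  ker⊆im : ∀ e → π e R.≈ R.ε → Σ Xᴳ.Carrier λ x → ι x E.≈ e
  ker⊆im ((r , y) , y-ok) r≈ε =
    (y , λ i → integral-resp-≃ (-‿≃0 y (select-0 (parity i)))
                               (y-ok (RC.coordinate-resp-≈ (R.sym r≈ε) RC.coordinate-ε) i)) ,
    (R.sym r≈ε , QP.≃-refl)

  extension : ShortExact X E R
  extension = record
    { ι = ι
    ; π = π
    ; ι-hom = isHom X E ι (λ x≈y → R.refl , x≈y) (λ _ _ → R.sym (R.identityʳ R.ε) , QP.≃-refl)
                         (R.refl , QP.≃-refl) (λ _ → R.sym R.ε⁻¹≈ε , QP.≃-refl)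
    ; π-hom = isHom E R π proj₁ (λ _ _ → R.refl) R.refl (λ _ → R.refl)
    ; ι-inj = λ _ _ → proj₂
    ; π-surj = π-surjective
    ; πι≈0 = λ _ → R.refl
    ; ker⊆im = ker⊆im }

  ×-proj₂ : ∀ n x → proj₂ (RawMonoid._×_ (AbelianGroup.rawMonoid R×ℚ) n x) ≃ n ℚᴳ.×ℕ proj₂ x
  ×-proj₂ zero    x = QP.≃-refl
  ×-proj₂ (suc n) x = QP.+-congʳ (proj₂ x) (×-proj₂ n x)

  s-1 : ℕ → ℕ
  s-1 i = ℕ.pred (s i)

  s≡1+s-1 : ∀ i → s i ≡ suc (s-1 i)
  s≡1+s-1 i = P.sym (ℕP.suc-pred (s i) {{prime⇒nonZero (s-prime i)}})

  1/s : ℕ → ℚᵘ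
  1/s i = mkℚᵘ (+ 1) (s-1 i)

  QuotientAdmissible : ℚᵘ → Set
  QuotientAdmissible l = ∀ i → Integral (s i) (l Q.* 1/s i Q.- select (parity i) (1/s i))

  s∣numerator : ∀ L dl → QuotientAdmissible (mkℚᵘ L dl) →
    ∀ i → s i ∣ ∣ L ℤ.- selectℤ (parity i) (+ 1) ℤ.* + suc dl ∣
  s∣numerator L dl admissible-l i =
    integral-l/p-e/p⇒p∣ (s-prime i) (s≡1+s-1 i) L dl (selectℤ (parity i) (+ 1))
    (integral-resp-≃ (QP.+-congʳ _ (QP.-‿cong (select-mkℚᵘ (parity i) (+ 1) (s-1 i)))) (admissible-l i))

  -- at even indices s i divides the numerator of l, at odd ones its denominator
  no-quotient-admissible : ∀ l → ¬ QuotientAdmissible l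
  no-quotient-admissible (mkℚᵘ L dl) admissible-l = ℕP.1+n≢0 (∣∧<⇒≡0 s₁∣dl dl<s₁)
    where
    N i₀ i₁ : ℕ
    N = ∣ L ∣ ℕ.+ suc dl
    i₀ = 2 ℕ.* N
    i₁ = suc i₀
    parity₀ : parity i₀ ≡ 0ℙ
    parity₀ = ParityP.*-homo-* 2 N
    parity₁ : parity i₁ ≡ 1ℙ
    parity₁ = P.trans (ParityP.+-homo-+ 1 i₀) (P.cong (ℙ._+_ 1ℙ) parity₀)
    i₀≥N : N ≤ i₀
    i₀≥N = ℕP.m≤n*m N 2
    s₀∣L : s i₀ ∣ ∣ L ∣
    s₀∣L = P.subst (λ t → s i₀ ∣ ∣ t ∣)
      (P.trans (P.cong (λ π → L ℤ.- selectℤ π (+ 1) ℤ.* + suc dl) parity₀) (minus-0* L (+ suc dl)))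
      (s∣numerator L dl admissible-l i₀)
      where
      minus-0* : ∀ L D → L ℤ.- + 0 ℤ.* D ≡ L
      minus-0* = solve-∀
    L≡0 : L ≡ + 0
    L≡0 = ℤP.∣i∣≡0⇒i≡0 (∣∧<⇒≡0 s₀∣L
      (ℕP.≤-<-trans (ℕP.≤-trans (ℕP.m≤m+n ∣ L ∣ (suc dl)) i₀≥N) (i<s i₀)))
    s₁∣dl : s i₁ ∣ suc dl
    s₁∣dl = P.subst (λ t → s i₁ ∣ ∣ t ∣)
      (P.trans (P.cong₂ (λ x π → x ℤ.- selectℤ π (+ 1) ℤ.* + suc dl) L≡0 parity₁) (0-1* (+ suc dl)))
      (s∣numerator L dl admissible-l i₁)
      where
      0-1* : ∀ D → + 0 ℤ.- + 1 ℤ.* D ≡ ℤ.- D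
      0-1* = solve-∀
    dl<s₁ : suc dl < s i₁
    dl<s₁ = ℕP.≤-<-trans (ℕP.≤-trans (ℕP.m≤n+m (suc dl) ∣ L ∣) (ℕP.≤-trans i₀≥N (ℕP.n≤1+n i₀))) (i<s i₁)

  not-split : ¬ Splits extension
  not-split (σ , σ-hom , π∘σ) = no-quotient-admissible (y b) quotient-admissible
    where
    module σ = HomomorphismProperties {R} {E} σ-hom

    y : R.Carrier → ℚᵘ
    y r = proj₂ (proj₁ (σ r))

    y-× : ∀ n r → y (n R.×ℕ r) ≃ n ℚᴳ.×ℕ y r
    y-× n r = QP.≃-trans (proj₂ (σ.homo-× n r))
                (QP.≃-trans (proj₂ (×-proj₁ n (σ r))) (×-proj₂ n (proj₁ (σ r))))

    quotient-admissible : QuotientAdmissible (y b)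
    quotient-admissible i = integral-resp-≃ (QP.+-congˡ (Q.- select (parity i) (1/s i)) yᵢ≃yb/s)
                                            (proj₂ (σ rᵢ) σrᵢ-coordinate i)
      where
      rᵢ : R.Carrier
      rᵢ = proj₁ (b-divisible i)
      srᵢ≈b : suc (s-1 i) R.×ℕ rᵢ R.≈ b
      srᵢ≈b = P.subst (λ m → m R.×ℕ rᵢ R.≈ b) (s≡1+s-1 i) (proj₂ (b-divisible i))
      σrᵢ-coordinate : RC.Coordinate (π (σ rᵢ)) (1/s i)
      σrᵢ-coordinate = RC.mkCoordinate
        (R.trans (R.×-congʳ (suc (s-1 i)) (π∘σ rᵢ)) (R.trans srᵢ≈b (R.sym (R.·-identityˡ b))))
      yᵢ≃yb/s : y rᵢ ≃ y b Q.* 1/s i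
      yᵢ≃yb/s = ×≃⇒≃*1/ (y rᵢ) (y b) (s-1 i)
        (QP.≃-trans (QP.≃-sym (y-× (suc (s-1 i)) rᵢ)) (proj₂ (σ.⟦⟧-cong srᵢ≈b)))

  Ext-nonvanishing : ¬ ExtZero R X
  Ext-nonvanishing ext = not-split (ext E extension)

-- Choosing the primes

increasing-sequence : {Q : ℕ → Set} → (∀ n → Σ ℕ λ p → n ≤ p × Q p) → ∀ B →
  Σ (ℕ → ℕ) λ s → (∀ i → s i < s (suc i)) × (∀ i → B ≤ s i) × (∀ i → Q (s i))
increasing-sequence {Q} unbounded B = s , s-increasing , B≤s , Q-s
  where
  s : ℕ → ℕ
  s zero    = proj₁ (unbounded B)
  s (suc i) = proj₁ (unbounded (suc (s i) ℕ.+ B))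
  s-increasing : ∀ i → s i < s (suc i)
  s-increasing i = ℕP.≤-trans (ℕP.m≤m+n (suc (s i)) B) (proj₁ (proj₂ (unbounded (suc (s i) ℕ.+ B))))
  B≤s : ∀ i → B ≤ s i
  B≤s zero    = proj₁ (proj₂ (unbounded B))
  B≤s (suc i) = ℕP.≤-trans (ℕP.m≤n+m B (suc (s i))) (proj₁ (proj₂ (unbounded (suc (s i) ℕ.+ B))))
  Q-s : ∀ i → Q (s i)
  Q-s zero    = proj₂ (proj₂ (unbounded B))
  Q-s (suc i) = proj₂ (proj₂ (unbounded (suc (s i) ℕ.+ B)))

module _ {A : AbGroup} {a : AbelianGroup.Carrier A} {χ : Characteristic} (a-χ : IsCharOf A a χ)
  {p : ℕ} (p-prime : Prime p) where

  height-zero⇒indivisible : χ p ≡ fin 0 → ¬ DivIn A p a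
  height-zero⇒indivisible χp≡0 p∣a with P.subst (1 ≤ᶠ_) χp≡0
    (proj₁ (a-χ p p-prime 1) (P.subst (λ m → DivIn A m a) (P.sym (ℕP.^-identityʳ p)) p∣a))
  ... | ()

  height-positive⇒divisible : ∀ {k} → χ p ≡ fin (suc k) → DivIn A p a
  height-positive⇒divisible χp≡1+k = P.subst (λ m → DivIn A m a) (ℕP.^-identityʳ p)
    (proj₂ (a-χ p p-prime 1) (P.subst (1 ≤ᶠ_) (P.sym χp≡1+k) (s≤s z≤n)))

proposition1p6 : (T R : AbGroup) → RankOneTorsionFree T → RankOneTorsionFree R
    → (τ ρ : Characteristic) → HasType T τ → HasType R ρ
    → (∀ p → Prime p → τ p ≤∞ ρ p)
    → ¬ SameType τ ρ
    → (∀ n → Σ ℕ (λ p → n ≤ p × Prime p × τ p ≡ fin 0 × Σ ℕ (λ k → ρ p ≡ fin (suc k))))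
    → Σ AbGroup (λ X → RankOneTorsionFree X × ExtZero T X × ¬ ExtZero R X)
proposition1p6 T R (torsionFreeT , rankOneT) (torsionFreeR , rankOneR) τ ρ
  (a , a≉ε , χ , a-χ , (N , χ≡τ) , _) (b , b≉ε , ψ , b-ψ , (M , ψ≡ρ) , _) _ _ P-infinite
  with increasing-sequence P-infinite (N ℕ.+ M)
... | s , s-increasing , N+M≤s , s∈P =
  X , X-rankOneTorsionFree ,
  ExtVanishing.Ext-vanishes s s-prime T torsionFreeT rankOneT a a≉ε a-indivisible ,
  ExtNonvanishing.Ext-nonvanishing s s-prime s-increasing R torsionFreeR rankOneR b b≉ε b-divisible
  where
  s-prime : ∀ i → Prime (s i)
  s-prime i = proj₁ (s∈P i)
  open PrimeSequence s s-prime using (X; X-rankOneTorsionFree)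
  a-indivisible : ∀ i → ¬ DivIn T (s i) a
  a-indivisible i = height-zero⇒indivisible {T} a-χ (s-prime i)
    (P.trans (χ≡τ (s i) (s-prime i) (ℕP.≤-trans (ℕP.m≤m+n N M) (N+M≤s i))) (proj₁ (proj₂ (s∈P i))))
  b-divisible : ∀ i → DivIn R (s i) b
  b-divisible i = height-positive⇒divisible {R} b-ψ (s-prime i)
    (P.trans (ψ≡ρ (s i) (s-prime i) (ℕP.≤-trans (ℕP.m≤n+m M N) (N+M≤s i))) (proj₂ (proj₂ (proj₂ (s∈P i)))))
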